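{- Let $\Delta$ be a finite saturated sample set, $\delta$ a $\Delta$-diagram, and $t_1,t_2$ basic terms. If time warps $f_1$ and $f_2$ strongly extend $\mathrm{diag}_{t_1}(\delta)$ and $\mathrm{diag}_{t_2}(\delta)$ respectively, then $f_1\circ f_2$ strongly extends $\mathrm{diag}_{t_1\cdot t_2}(\delta)$.
   Context: Let $\omega^+=\omega\cup\{\omega\}$ with its natural order; $S(n)=n+1$ for $n\in\omega$, $S(\omega)=\omega$. A time warp is a join-preserving map $\omega^+\to\omega^+$ (equivalently, order-preserving with $f(0)=0$ and $f(\omega)=\sup_{n\in\omega}f(n)$); $\mathrm{last}(f)=\min\{m\in\omega^+\mid f(m)=f(\omega)\}$. Basic terms are built from variables using $\cdot$, ${}'$, $1$. Samples: fix a countably infinite set of time variables $\kappa$. Samples are generated by $\alpha::=\kappa\mid t[\alpha]\mid\mathrm{suc}(\alpha)\mid\mathrm{last}(t)$ with $t$ basic (purely syntactic). Let $\leadsto$ be given, for basic $t,u$ and samples $\alpha$, by: $t[\alpha]\leadsto\alpha$; $(t\cdot u)[\alpha]\leadsto t[u[\alpha]]$; $\mathrm{suc}(\alpha)\leadsto\alpha$; $t'[\alpha]\leadsto t[t'[\alpha]]$; $t[\alpha]\leadsto t[\mathrm{last}(t)]$; $t'[\alpha]\leadsto t[\mathrm{suc}(t'[\alpha])]$. $\Delta$ is saturated if $\alpha\in\Delta$, $\alpha\leadsto\beta$ imply $\beta\in\Delta$. A $\Delta$-diagram is a map $\delta\colon\Delta\to\omega^+$ such that: (1) $t[\alpha],t[\beta]\in\Delta$,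 $\delta(\alpha)\le\delta(\beta)$ imply $\delta(t[\alpha])\le\delta(t[\beta])$; (2) $t[\alpha]\in\Delta$, $\delta(\alpha)=0$ imply $\delta(t[\alpha])=0$; (3) $\mathrm{suc}(\alpha)\in\Delta$ implies $\delta(\mathrm{suc}(\alpha))=S(\delta(\alpha))$; (4) for $t[\alpha]\in\Delta$: $\delta(\mathrm{last}(t))\le\delta(\alpha)$ iff $\delta(t[\mathrm{last}(t)])=\delta(t[\alpha])$; (5) $t[\mathrm{last}(t)]\in\Delta$, $\delta(\mathrm{last}(t))=\omega$ imply $\delta(t[\mathrm{last}(t)])=\omega$; (6) $1[\alpha]\in\Delta$ implies $\delta(1[\alpha])=\delta(\alpha)$; (7) $\mathrm{last}(1)\in\Delta$ implies $\delta(\mathrm{last}(1))=\omega$; (8) $(t\cdot u)[\alpha]\in\Delta$ implies $\delta((t\cdot u)[\alpha])=\delta(t[u[\alpha]])$; (9) $\mathrm{last}(t\cdot u),\mathrm{last}(t),\mathrm{last}(u)\in\Delta$, $\delta(\mathrm{last}(t\cdot u))=\omega$ imply $\delta(\mathrm{last}(t))=\delta(\mathrm{last}(u))=\omega$; (10) $t'[\alpha]\in\Delta$, $0<\delta(\alpha)<\omega$ imply $\delta(t[t'[\alpha]])<\delta(\alpha)$; (11) $t'[\alpha]\in\Delta$, $\delta(t'[\alpha])<\omega$ imply $\delta(\alpha)\le\delta(t[\mathrm{suc}(t'[\alpha])])$; (12) $\mathrm{last}(t'),\mathrm{last}(t)\in\Delta$, $\delta(\mathrm{last}(t'))=\omega$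 imply $\delta(\mathrm{last}(t))=\omega$. For a basic term $t$, $\mathrm{diag}_t(\delta)=\{(\delta(\alpha),\delta(t[\alpha]))\mid t[\alpha]\in\Delta\}$. A time warp $f$ extends $\mathrm{diag}_t(\delta)$ if $f(i)=j$ for all $(i,j)\in\mathrm{diag}_t(\delta)$; it strongly extends $\mathrm{diag}_t(\delta)$ if it extends it and, whenever $\mathrm{diag}_t(\delta)\neq\emptyset$ and $\delta(\mathrm{last}(t))=\omega$, also $\mathrm{last}(f)=\omega$. -}

module Defs where

open import Data.Nat using (ℕ; zero; suc) renaming (_≤_ to _≤ℕ_)
open import Data.Product using (_×_; Σ; ∃)
open import Data.List using (List)
open import Data.List.Membership.Propositional using (_∈_)
open import Relation.Binary.PropositionalEquality using (_≡_; _≢_)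
open import Function.Bundles using (_⇔_)

data ω⁺ : Set where
  fin : ℕ → ω⁺
  ω   : ω⁺

infix 4 _≤ω_ _<ω_
data _≤ω_ : ω⁺ → ω⁺ → Set where
  fin≤fin : ∀ {m n} → m ≤ℕ n → fin m ≤ω fin n
  ≤ω-top  : ∀ {x} → x ≤ω ω

_<ω_ : ω⁺ → ω⁺ → Set
x <ω y = x ≤ω y × x ≢ y

S : ω⁺ → ω⁺
S (fin n) = fin (suc n)
S ω = ω

record TimeWarp : Set where
  field
    fun     : ω⁺ → ω⁺
    mono    : ∀ {x y} → x ≤ω y → fun x ≤ω fun y
    zero↦0  : fun (fin zero) ≡ fin zero
    ω-ub    : ∀ n → fun (fin n) ≤ω fun ω
    ω-least : ∀ u → (∀ n → fun (fin n) ≤ω u) → fun ω ≤ω u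
open TimeWarp public

IsLast : (ω⁺ → ω⁺) → ω⁺ → Set
IsLast f m = (f m ≡ f ω) × (∀ k → f k ≡ f ω → m ≤ω k)

data Term : Set where
  var  : ℕ → Term
  _·_  : Term → Term → Term
  _′   : Term → Term
  one  : Term

data Sample : Set where
  κ    : ℕ → Sample
  _[_] : Term → Sample → Sample
  sucS : Sample → Sample
  lastS : Term → Sample

infix 4 _⇝_
data _⇝_ : Sample → Sample → Set where
  r1 : ∀ t α → t [ α ] ⇝ α
  r2 : ∀ t u α → (t · u) [ α ] ⇝ t [ u [ α ] ]
  r3 : ∀ α → sucS α ⇝ α
  r4 : ∀ t α → (t ′) [ α ] ⇝ t [ (t ′) [ α ] ]
  r5 : ∀ t α → t [ α ] ⇝ t [ lastS t ]
  r6 : ∀ t α → (t ′) [ α ] ⇝ t [ sucS ((t ′) [ α ]) ]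

Saturated : List Sample → Set
Saturated Δ = ∀ α β → α ∈ Δ → α ⇝ β → β ∈ Δ

-- Δ-diagram; δ is given as a total map, only its values on Δ matter
record IsDiagram (Δ : List Sample) (δ : Sample → ω⁺) : Set where
  field
    c1  : ∀ t α β → t [ α ] ∈ Δ → t [ β ] ∈ Δ → δ α ≤ω δ β → δ (t [ α ]) ≤ω δ (t [ β ])
    c2  : ∀ t α → t [ α ] ∈ Δ → δ α ≡ fin zero → δ (t [ α ]) ≡ fin zero
    c3  : ∀ α → sucS α ∈ Δ → δ (sucS α) ≡ S (δ α)
    c4  : ∀ t α → t [ α ] ∈ Δ → (δ (lastS t) ≤ω δ α) ⇔ (δ (t [ lastS t ]) ≡ δ (t [ α ]))
    c5  : ∀ t → t [ lastS t ] ∈ Δ → δ (lastS t) ≡ ω → δ (t [ lastS t ]) ≡ ω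
    c6  : ∀ α → one [ α ] ∈ Δ → δ (one [ α ]) ≡ δ α
    c7  : lastS one ∈ Δ → δ (lastS one) ≡ ω
    c8  : ∀ t u α → (t · u) [ α ] ∈ Δ → δ ((t · u) [ α ]) ≡ δ (t [ u [ α ] ])
    c9  : ∀ t u → lastS (t · u) ∈ Δ → lastS t ∈ Δ → lastS u ∈ Δ →
          δ (lastS (t · u)) ≡ ω → (δ (lastS t) ≡ ω) × (δ (lastS u) ≡ ω)
    c10 : ∀ t α → (t ′) [ α ] ∈ Δ → fin zero <ω δ α → δ α <ω ω →
          δ (t [ (t ′) [ α ] ]) <ω δ α
    c11 : ∀ t α → (t ′) [ α ] ∈ Δ → δ ((t ′) [ α ]) <ω ω →
          δ α ≤ω δ (t [ sucS ((t ′) [ α ]) ])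
    c12 : ∀ t → lastS (t ′) ∈ Δ → lastS t ∈ Δ → δ (lastS (t ′)) ≡ ω → δ (lastS t) ≡ ω

-- f extends diag_t(δ) = {(δ α, δ (t[α])) | t[α] ∈ Δ}
Extends : List Sample → (Sample → ω⁺) → Term → (ω⁺ → ω⁺) → Set
Extends Δ δ t f = ∀ α → t [ α ] ∈ Δ → f (δ α) ≡ δ (t [ α ])

StronglyExtends : List Sample → (Sample → ω⁺) → Term → (ω⁺ → ω⁺) → Set
StronglyExtends Δ δ t f =
  Extends Δ δ t f ×
  ((∃ λ α → t [ α ] ∈ Δ) → δ (lastS t) ≡ ω → IsLast f ω)

-- Extension of diag_{t₁·t₂}(δ) is pointwise: (t₁·t₂)[α] has the value of t₁[t₂[α]], and
-- saturation puts t₂[α] and t₁[t₂[α]] in Δ. For strong extension, axiom (9) gives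
-- δ(last t₁) = δ(last t₂) = ω, hence last f₁ = last f₂ = ω. A time warp with last f = ω
-- has f ω = ω (otherwise f ω would be a finite supremum never attained), so f₁ (f₂ k) = f₁ (f₂ ω)
-- forces f₂ k = ω = f₂ ω and then k = ω.
module Submission where

open import Defs
open import Data.Empty using (⊥; ⊥-elim)
open import Data.List using (List)
open import Data.List.Membership.Propositional using (_∈_)
open import Data.Nat using (zero; suc)
open import Data.Nat.Properties using (≤∧≢⇒<; m<1+n⇒m≤n; 1+n≰n)
open import Data.Product using (_×_; ∃; _,_; proj₁; proj₂)
open import Function using (_∘_)
open import Relation.Binary.PropositionalEquality using (_≡_; _≢_; refl; sym; trans; cong; subst)

ω≤⇒≡ω : ∀ {x} → ω ≤ω x → x ≡ ω
ω≤⇒≡ω ≤ω-top = refl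

ω≰fin : ∀ {n} → ω ≤ω fin n → ⊥
ω≰fin ()

≤fin-suc∧≢⇒≤fin : ∀ {x p} → x ≤ω fin (suc p) → x ≢ fin (suc p) → x ≤ω fin p
≤fin-suc∧≢⇒≤fin (fin≤fin m≤1+p) x≢1+p = fin≤fin (m<1+n⇒m≤n (≤∧≢⇒< m≤1+p (x≢1+p ∘ cong fin)))

IsLast-ω⇒ω↦ω : (f : TimeWarp) → IsLast (fun f) ω → fun f ω ≡ ω
IsLast-ω⇒ω↦ω f (_ , minimal) = sup-is-ω (fun f ω) refl
  where
  unattained : ∀ j → fun f (fin j) ≢ fun f ω
  unattained j e = ω≰fin (minimal (fin j) e)

  sup-is-ω : ∀ x → fun f ω ≡ x → x ≡ ω
  sup-is-ω ω _ = refl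
  sup-is-ω (fin zero) eq = ⊥-elim (unattained zero (trans (zero↦0 f) (sym eq)))
  sup-is-ω (fin (suc p)) eq with subst (_≤ω fin p) eq (ω-least f (fin p) bounded)
    where
    bounded : ∀ j → fun f (fin j) ≤ω fin p
    bounded j = ≤fin-suc∧≢⇒≤fin (subst (fun f (fin j) ≤ω_) eq (ω-ub f j))
                                  (λ e → unattained j (trans e (sym eq)))
  ... | fin≤fin 1+p≤p = ⊥-elim (1+n≰n 1+p≤p)

IsLast-ω-∘ : (g : ω⁺ → ω⁺) (h : TimeWarp) →
             IsLast g ω → IsLast (fun h) ω → IsLast (g ∘ fun h) ω
IsLast-ω-∘ g h (_ , g-minimal) (_ , h-minimal) = refl , minimal
  where
  hω≡ω : fun h ω ≡ ω
  hω≡ω = IsLast-ω⇒ω↦ω h (refl , h-minimal)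

  minimal : ∀ k → g (fun h k) ≡ g (fun h ω) → ω ≤ω k
  minimal k e = h-minimal k (trans (ω≤⇒≡ω (g-minimal (fun h k) (trans e (cong g hω≡ω))))
                                   (sym hω≡ω))

module _ {Δ : List Sample} (sat : Saturated Δ) where

  ∈-·-outer : ∀ {t u α} → (t · u) [ α ] ∈ Δ → t [ u [ α ] ] ∈ Δ
  ∈-·-outer {t} {u} {α} m = sat _ _ m (r2 t u α)

  ∈-·-inner : ∀ {t u α} → (t · u) [ α ] ∈ Δ → u [ α ] ∈ Δ
  ∈-·-inner {t} {u} {α} m = sat _ _ (∈-·-outer m) (r1 t (u [ α ]))

  ∈-lastS : ∀ {t α} → t [ α ] ∈ Δ → lastS t ∈ Δ
  ∈-lastS {t} {α} m = sat _ _ (sat _ _ m (r5 t α)) (r1 t (lastS t))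

  Extends-· : ∀ {δ t u} (f g : ω⁺ → ω⁺) → IsDiagram Δ δ →
              Extends Δ δ t f → Extends Δ δ u g → Extends Δ δ (t · u) (f ∘ g)
  Extends-· {δ} {t} {u} f g D ext-t ext-u α m =
    trans (cong f (ext-u α (∈-·-inner m)))
          (trans (ext-t (u [ α ]) (∈-·-outer m)) (sym (IsDiagram.c8 D t u α m)))

lemma3p5 : (Δ : List Sample) → Saturated Δ → (δ : Sample → ω⁺) → IsDiagram Δ δ →
           (t₁ t₂ : Term) (f₁ f₂ : TimeWarp) →
           StronglyExtends Δ δ t₁ (fun f₁) → StronglyExtends Δ δ t₂ (fun f₂) →
           StronglyExtends Δ δ (t₁ · t₂) (fun f₁ ∘ fun f₂)
lemma3p5 Δ sat δ D t₁ t₂ f₁ f₂ (ext₁ , last₁) (ext₂ , last₂) =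
  Extends-· sat (fun f₁) (fun f₂) D ext₁ ext₂ , strong
  where
  strong : (∃ λ α → (t₁ · t₂) [ α ] ∈ Δ) → δ (lastS (t₁ · t₂)) ≡ ω →
           IsLast (fun f₁ ∘ fun f₂) ω
  strong (α , m) δ-last≡ω = IsLast-ω-∘ (fun f₁) f₂ (last₁ (_ , outer) (proj₁ lasts-ω))
                                                    (last₂ (_ , inner) (proj₂ lasts-ω))
    where
    outer : t₁ [ t₂ [ α ] ] ∈ Δ
    outer = ∈-·-outer sat m
    inner : t₂ [ α ] ∈ Δ
    inner = ∈-·-inner sat m
    lasts-ω : (δ (lastS t₁) ≡ ω) × (δ (lastS t₂) ≡ ω)
    lasts-ω = IsDiagram.c9 D t₁ t₂ (∈-lastS sat m) (∈-lastS sat outer) (∈-lastS sat inner)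
                           δ-last≡ω
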